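{- (Subject Reduction) In the Fitch-style calculus for $IK$: if $\Gamma\vdash t:A$ is derivable and $t\mapsto u$, then $\Gamma\vdash u:A$ is derivable.
   Context: Types: $A,B ::= p \mid 1 \mid A\times B \mid A\to B \mid 0 \mid A+B \mid \Box A$ ($p$ atoms). Contexts: $\Gamma ::= \cdot \mid \Gamma,x:A \mid \Gamma,\bullet$ (variables distinct; $\bullet$ is a structural symbol called a lock). Terms: $x$, $\langle\rangle$, $\langle t,u\rangle$, $\pi_1 t$, $\pi_2 t$, $\lambda x.t$, $t\,u$, $\mathrm{inl}\,t$, $\mathrm{inr}\,t$, $\mathrm{case}\ s\ \mathrm{of}\ (x.t;\,y.u)$, $\mathrm{abort}\,t$, $\mathrm{shut}\,t$, $\mathrm{open}\,t$. Typing rules: (var) $\Gamma,x:A,\Gamma'\vdash x:A$ provided $\Gamma'$ contains no lock; (products) $\Gamma\vdash\langle\rangle:1$; from $\Gamma\vdash t:A$, $\Gamma\vdash u:B$ infer $\Gamma\vdash\langle t,u\rangle:A\times B$; from $\Gamma\vdash t:A_1\times A_2$ infer $\Gamma\vdash\pi_i t:A_i$; (functions) from $\Gamma,x:A\vdash t:B$ infer $\Gamma\vdash\lambda x.t:A\to B$; from $\Gamma\vdash t:A\to B$, $\Gamma\vdash u:A$ infer $\Gamma\vdash t\,u:B$; (sums) from $\Gamma\vdash t:A$ infer $\Gamma\vdash\mathrm{inl}\,t:A+B$; symmetrically for $\mathrm{inr}$; from $\Gamma\vdash s:A+B$, $\Gamma,x:A,\Gamma'\vdash t:C$, $\Gamma,y:B,\Gamma'\vdash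 u:C$ infer $\Gamma,\Gamma'\vdash\mathrm{case}\ s\ \mathrm{of}\ (x.t;\,y.u):C$ (any $\Gamma'$); from $\Gamma\vdash t:0$ infer $\Gamma,\Gamma'\vdash\mathrm{abort}\,t:A$ (any $\Gamma'$); (shut) from $\Gamma,\bullet\vdash t:A$ infer $\Gamma\vdash\mathrm{shut}\,t:\Box A$; (open) from $\Gamma\vdash t:\Box A$ infer $\Gamma,\bullet,\Gamma'\vdash\mathrm{open}\,t:A$ provided $\Gamma'$ contains no lock. Reduction: $\mapsto$ is the closure under all term formers (reduction anywhere inside a term) of the rules $(\lambda x.t)\,u\mapsto t[u/x]$; $\pi_i\langle t_1,t_2\rangle\mapsto t_i$; $\mathrm{case}\ (\mathrm{inl}\,s)\ \mathrm{of}\ (x.t;\,y.u)\mapsto t[s/x]$; $\mathrm{case}\ (\mathrm{inr}\,s)\ \mathrm{of}\ (x.t;\,y.u)\mapsto u[s/y]$; $\mathrm{open}\,\mathrm{shut}\,t\mapsto t$; and the commuting conversions $E[\mathrm{case}\ s\ \mathrm{of}\ (x.t;\,y.u)]\mapsto\mathrm{case}\ s\ \mathrm{of}\ (x.E[t];\,y.E[u])$ and $E[\mathrm{abort}\,t]\mapsto\mathrm{abort}\,t$ for every elimination frame $E[-]$ among $[-]\,v$, $\pi_1[-]$, $\pi_2[-]$, $\mathrm{case}\ [-]\ \mathrm{of}\ (x'.t';\,y'.u')$, $\mathrm{abort}[-]$, $\mathrm{open}[-]$ (in particular $\mathrm{open}\,(\mathrm{case}\ s\ \mathrm{of}\ (x.t;\,y.u))\mapsto\mathrm{case}\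 s\ \mathrm{of}\ (x.\mathrm{open}\,t;\,y.\mathrm{open}\,u)$ and $\mathrm{open}\,\mathrm{abort}\,t\mapsto\mathrm{abort}\,t$). -}

module Defs where

-- Terms use de Bruijn indices (= terms up to
-- alpha-equivalence); an index counts only the VARIABLE entries of the
-- context from the right (locks are not counted).

open import Data.Nat using (ℕ; zero; suc; _+_; _<ᵇ_; _≡ᵇ_)
open import Data.Bool using (if_then_else_)
open import Data.Empty using (⊥)
open import Data.Unit using (⊤)

infixr 7 _⊗_
infixr 6 _⊕_
infixr 5 _⇒_

data Ty : Set where
  atom : ℕ → Ty
  𝟙    : Ty
  _⊗_  : Ty → Ty → Ty
  _⇒_  : Ty → Ty → Ty
  𝟘    : Ty
  _⊕_  : Ty → Ty → Ty
  □    : Ty → Ty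

infixl 4 _,_
data Ctx : Set where
  ·    : Ctx
  _,_  : Ctx → Ty → Ctx
  _,•  : Ctx → Ctx

infixl 3 _⧺_
_⧺_ : Ctx → Ctx → Ctx
Γ ⧺ ·        = Γ
Γ ⧺ (Δ , A)  = (Γ ⧺ Δ) , A
Γ ⧺ (Δ ,•)   = (Γ ⧺ Δ) ,•

LockFree : Ctx → Set
LockFree ·        = ⊤
LockFree (Δ , _)  = LockFree Δ
LockFree (Δ ,•)   = ⊥

nvars : Ctx → ℕ
nvars ·        = 0
nvars (Δ , _)  = suc (nvars Δ)
nvars (Δ ,•)   = nvars Δ

-- Raw terms.  lam t binds index 0 in t; case s t u binds index 0 in t and in u.
data Tm : Set where
  var   : ℕ → Tm
  unit  : Tm
  pair  : Tm → Tm → Tm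
  π₁    : Tm → Tm
  π₂    : Tm → Tm
  lam   : Tm → Tm
  app   : Tm → Tm → Tm
  inl   : Tm → Tm
  inr   : Tm → Tm
  case  : Tm → Tm → Tm → Tm
  abort : Tm → Tm
  shut  : Tm → Tm
  open′ : Tm → Tm

lift : (ℕ → ℕ) → ℕ → ℕ
lift ρ zero    = zero
lift ρ (suc i) = suc (ρ i)

ren : (ℕ → ℕ) → Tm → Tm
ren ρ (var i)      = var (ρ i)
ren ρ unit         = unit
ren ρ (pair t u)   = pair (ren ρ t) (ren ρ u)
ren ρ (π₁ t)       = π₁ (ren ρ t)
ren ρ (π₂ t)       = π₂ (ren ρ t)
ren ρ (lam t)      = lam (ren (lift ρ) t)
ren ρ (app t u)    = app (ren ρ t) (ren ρ u)
ren ρ (inl t)      = inl (ren ρ t)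
ren ρ (inr t)      = inr (ren ρ t)
ren ρ (case s t u) = case (ren ρ s) (ren (lift ρ) t) (ren (lift ρ) u)
ren ρ (abort t)    = abort (ren ρ t)
ren ρ (shut t)     = shut (ren ρ t)
ren ρ (open′ t)    = open′ (ren ρ t)

wk : ℕ → Tm → Tm
wk n = ren (n +_)

-- The renaming relating a branch typed in  Γ , x:A , Γ'  (x has index n =
-- nvars Γ') to the same branch written under the binder of case in the
-- ambient context  Γ , Γ'  (x has index 0): the cyclic permutation moving n to 0.
mv : ℕ → ℕ → ℕ
mv n k = if k <ᵇ n then suc k else (if k ≡ᵇ n then zero else k)

exts : (ℕ → Tm) → ℕ → Tm
exts σ zero    = var zero
exts σ (suc i) = ren suc (σ i)

sub : (ℕ → Tm) → Tm → Tm
sub σ (var i)      = σ i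
sub σ unit         = unit
sub σ (pair t u)   = pair (sub σ t) (sub σ u)
sub σ (π₁ t)       = π₁ (sub σ t)
sub σ (π₂ t)       = π₂ (sub σ t)
sub σ (lam t)      = lam (sub (exts σ) t)
sub σ (app t u)    = app (sub σ t) (sub σ u)
sub σ (inl t)      = inl (sub σ t)
sub σ (inr t)      = inr (sub σ t)
sub σ (case s t u) = case (sub σ s) (sub (exts σ) t) (sub (exts σ) u)
sub σ (abort t)    = abort (sub σ t)
sub σ (shut t)     = shut (sub σ t)
sub σ (open′ t)    = open′ (sub σ t)

σ₀ : Tm → ℕ → Tm
σ₀ u zero    = u
σ₀ u (suc i) = var i

_[_] : Tm → Tm → Tm
t [ u ] = sub (σ₀ u) t

infix 2 _⊢_∶_
data _⊢_∶_ : Ctx → Tm → Ty → Set where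
  ⊢var   : ∀ {Γ Γ′ A} → LockFree Γ′ → (Γ , A) ⧺ Γ′ ⊢ var (nvars Γ′) ∶ A
  ⊢unit  : ∀ {Γ} → Γ ⊢ unit ∶ 𝟙
  ⊢pair  : ∀ {Γ t u A B} → Γ ⊢ t ∶ A → Γ ⊢ u ∶ B → Γ ⊢ pair t u ∶ A ⊗ B
  ⊢π₁    : ∀ {Γ t A B} → Γ ⊢ t ∶ A ⊗ B → Γ ⊢ π₁ t ∶ A
  ⊢π₂    : ∀ {Γ t A B} → Γ ⊢ t ∶ A ⊗ B → Γ ⊢ π₂ t ∶ B
  ⊢lam   : ∀ {Γ t A B} → Γ , A ⊢ t ∶ B → Γ ⊢ lam t ∶ A ⇒ B
  ⊢app   : ∀ {Γ t u A B} → Γ ⊢ t ∶ A ⇒ B → Γ ⊢ u ∶ A → Γ ⊢ app t u ∶ B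
  ⊢inl   : ∀ {Γ t A B} → Γ ⊢ t ∶ A → Γ ⊢ inl t ∶ A ⊕ B
  ⊢inr   : ∀ {Γ t A B} → Γ ⊢ t ∶ B → Γ ⊢ inr t ∶ A ⊕ B
  -- from Γ ⊢ s : A+B, Γ,x:A,Γ' ⊢ t : C, Γ,y:B,Γ' ⊢ u : C infer Γ,Γ' ⊢ case s of (x.t; y.u) : C
  ⊢case  : ∀ {Γ Γ′ s t u A B C} → Γ ⊢ s ∶ A ⊕ B →
           (Γ , A) ⧺ Γ′ ⊢ t ∶ C → (Γ , B) ⧺ Γ′ ⊢ u ∶ C →
           Γ ⧺ Γ′ ⊢ case (wk (nvars Γ′) s) (ren (mv (nvars Γ′)) t) (ren (mv (nvars Γ′)) u) ∶ C
  ⊢abort : ∀ {Γ Γ′ t A} → Γ ⊢ t ∶ 𝟘 → Γ ⧺ Γ′ ⊢ abort (wk (nvars Γ′) t) ∶ A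
  ⊢shut  : ∀ {Γ t A} → Γ ,• ⊢ t ∶ A → Γ ⊢ shut t ∶ □ A
  ⊢open  : ∀ {Γ Γ′ t A} → LockFree Γ′ → Γ ⊢ t ∶ □ A →
           (Γ ,•) ⧺ Γ′ ⊢ open′ (wk (nvars Γ′) t) ∶ A

data Frame : Set where
  appF   : Tm → Frame
  π₁F    : Frame
  π₂F    : Frame
  caseF  : Tm → Tm → Frame
  abortF : Frame
  openF  : Frame

plug : Frame → Tm → Tm
plug (appF v)      t = app t v
plug π₁F           t = π₁ t
plug π₂F           t = π₂ t
plug (caseF t′ u′) t = case t t′ u′
plug abortF        t = abort t
plug openF         t = open′ t

-- the frame moved under one extra binder (the bound variable of the
-- commuted case), i.e. its free variables weakened by one
wkF : Frame → Frame
wkF (appF v)      = appF (ren suc v)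
wkF π₁F           = π₁F
wkF π₂F           = π₂F
wkF (caseF t′ u′) = caseF (ren (lift suc) t′) (ren (lift suc) u′)
wkF abortF        = abortF
wkF openF         = openF

infix 2 _↦_
data _↦_ : Tm → Tm → Set where
  β⇒      : ∀ {t u} → app (lam t) u ↦ t [ u ]
  β×₁     : ∀ {t u} → π₁ (pair t u) ↦ t
  β×₂     : ∀ {t u} → π₂ (pair t u) ↦ u
  β+₁     : ∀ {s t u} → case (inl s) t u ↦ t [ s ]
  β+₂     : ∀ {s t u} → case (inr s) t u ↦ u [ s ]
  β□      : ∀ {t} → open′ (shut t) ↦ t
  cc-case : ∀ E {s t u} → plug E (case s t u) ↦ case s (plug (wkF E) t) (plug (wkF E) u)
  cc-abort : ∀ E {t} → plug E (abort t) ↦ abort t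
  ξpair₁  : ∀ {t t′ u} → t ↦ t′ → pair t u ↦ pair t′ u
  ξpair₂  : ∀ {t u u′} → u ↦ u′ → pair t u ↦ pair t u′
  ξπ₁     : ∀ {t t′} → t ↦ t′ → π₁ t ↦ π₁ t′
  ξπ₂     : ∀ {t t′} → t ↦ t′ → π₂ t ↦ π₂ t′
  ξlam    : ∀ {t t′} → t ↦ t′ → lam t ↦ lam t′
  ξapp₁   : ∀ {t t′ u} → t ↦ t′ → app t u ↦ app t′ u
  ξapp₂   : ∀ {t u u′} → u ↦ u′ → app t u ↦ app t u′
  ξinl    : ∀ {t t′} → t ↦ t′ → inl t ↦ inl t′
  ξinr    : ∀ {t t′} → t ↦ t′ → inr t ↦ inr t′
  ξcase₁  : ∀ {s s′ t u} → s ↦ s′ → case s t u ↦ case s′ t u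
  ξcase₂  : ∀ {s t t′ u} → t ↦ t′ → case s t u ↦ case s t′ u
  ξcase₃  : ∀ {s t u u′} → u ↦ u′ → case s t u ↦ case s t u′
  ξabort  : ∀ {t t′} → t ↦ t′ → abort t ↦ abort t′
  ξshut   : ∀ {t t′} → t ↦ t′ → shut t ↦ shut t′
  ξopen   : ∀ {t t′} → t ↦ t′ → open′ t ↦ open′ t′

-- Contractions are handled by a substitution lemma for Fitch-style contexts: a
-- substitution must send every lock of its source to a lock of its target followed
-- by a lock-free extension, exactly the shape in which open eliminates a box.
-- Running the same proof for variable-for-variable substitutions first yields
-- weakening at any position, which the substitution lemma for terms needs under
-- binders.  Commuting conversions only re-associate the context extensions carried
-- by case, abort and open, at the price of arithmetic on de Bruijn indices.  Since
-- those rules type their subterms only up to a renaming, a step inside them is a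
-- step of a renamed term, and is reflected back to the original term.

module Submission where

open import Defs
open import Data.Bool using (true; false)
open import Data.Nat using (ℕ; zero; suc; _+_; _<_; _≤_; s≤s; _<ᵇ_; _≡ᵇ_)
open import Data.Nat.Properties
  using (+-suc; +-identityʳ; +-assoc; +-comm; <-cmp; ≤-reflexive; ≤-trans; <-≤-trans; m≤n+m; n≤1+n; <⇒≤; suc-injective)
open import Data.Product using (Σ; _×_) renaming (_,_ to _,,_)
open import Data.Unit using (tt)
open import Function using (id; _∘_)
open import Relation.Binary.Definitions using (tri<; tri≈; tri>)
open import Relation.Binary.PropositionalEquality hiding ([_])
open ≡-Reasoning

cong-case : ∀ {s s′ t t′ u u′} → s ≡ s′ → t ≡ t′ → u ≡ u′ → case s t u ≡ case s′ t′ u′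
cong-case refl refl refl = refl

lift-id : ∀ {ρ} → ρ ≗ id → lift ρ ≗ id
lift-id h zero    = refl
lift-id h (suc i) = cong suc (h i)

lift-∘ : ∀ ρ ρ′ → lift ρ ∘ lift ρ′ ≗ lift (ρ ∘ ρ′)
lift-∘ ρ ρ′ zero    = refl
lift-∘ ρ ρ′ (suc i) = refl

ren-id : ∀ {ρ} → ρ ≗ id → ren ρ ≗ id
ren-id h (var i)      = cong var (h i)
ren-id h unit         = refl
ren-id h (pair t u)   = cong₂ pair (ren-id h t) (ren-id h u)
ren-id h (π₁ t)       = cong π₁ (ren-id h t)
ren-id h (π₂ t)       = cong π₂ (ren-id h t)
ren-id h (lam t)      = cong lam (ren-id (lift-id h) t)
ren-id h (app t u)    = cong₂ app (ren-id h t) (ren-id h u)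
ren-id h (inl t)      = cong inl (ren-id h t)
ren-id h (inr t)      = cong inr (ren-id h t)
ren-id h (case s t u) = cong-case (ren-id h s) (ren-id (lift-id h) t) (ren-id (lift-id h) u)
ren-id h (abort t)    = cong abort (ren-id h t)
ren-id h (shut t)     = cong shut (ren-id h t)
ren-id h (open′ t)    = cong open′ (ren-id h t)

wk-zero : wk 0 ≗ id
wk-zero = ren-id (λ _ → refl)

exts-lift : ∀ {σ ρ σ′} → σ ∘ ρ ≗ σ′ → exts σ ∘ lift ρ ≗ exts σ′
exts-lift h zero    = refl
exts-lift h (suc i) = cong (ren suc) (h i)

sub-ren : ∀ {σ ρ σ′} → σ ∘ ρ ≗ σ′ → sub σ ∘ ren ρ ≗ sub σ′
sub-ren h (var i)      = h i
sub-ren h unit         = refl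
sub-ren h (pair t u)   = cong₂ pair (sub-ren h t) (sub-ren h u)
sub-ren h (π₁ t)       = cong π₁ (sub-ren h t)
sub-ren h (π₂ t)       = cong π₂ (sub-ren h t)
sub-ren h (lam t)      = cong lam (sub-ren (exts-lift h) t)
sub-ren h (app t u)    = cong₂ app (sub-ren h t) (sub-ren h u)
sub-ren h (inl t)      = cong inl (sub-ren h t)
sub-ren h (inr t)      = cong inr (sub-ren h t)
sub-ren h (case s t u) = cong-case (sub-ren h s) (sub-ren (exts-lift h) t) (sub-ren (exts-lift h) u)
sub-ren h (abort t)    = cong abort (sub-ren h t)
sub-ren h (shut t)     = cong shut (sub-ren h t)
sub-ren h (open′ t)    = cong open′ (sub-ren h t)

exts-var : ∀ {σ ρ} → σ ≗ var ∘ ρ → exts σ ≗ var ∘ lift ρ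
exts-var h zero    = refl
exts-var h (suc i) = cong (ren suc) (h i)

sub-var : ∀ {σ ρ} → σ ≗ var ∘ ρ → sub σ ≗ ren ρ
sub-var h (var i)      = h i
sub-var h unit         = refl
sub-var h (pair t u)   = cong₂ pair (sub-var h t) (sub-var h u)
sub-var h (π₁ t)       = cong π₁ (sub-var h t)
sub-var h (π₂ t)       = cong π₂ (sub-var h t)
sub-var h (lam t)      = cong lam (sub-var (exts-var h) t)
sub-var h (app t u)    = cong₂ app (sub-var h t) (sub-var h u)
sub-var h (inl t)      = cong inl (sub-var h t)
sub-var h (inr t)      = cong inr (sub-var h t)
sub-var h (case s t u) = cong-case (sub-var h s) (sub-var (exts-var h) t) (sub-var (exts-var h) u)
sub-var h (abort t)    = cong abort (sub-var h t)
sub-var h (shut t)     = cong shut (sub-var h t)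
sub-var h (open′ t)    = cong open′ (sub-var h t)

ren-ren : ∀ {ρ ρ′ ρ″} → ρ ∘ ρ′ ≗ ρ″ → ren ρ ∘ ren ρ′ ≗ ren ρ″
ren-ren {ρ} {ρ′} {ρ″} h t = begin
  ren ρ (ren ρ′ t)         ≡⟨ sub-var (λ _ → refl) (ren ρ′ t) ⟨
  sub (var ∘ ρ) (ren ρ′ t) ≡⟨ sub-ren (cong var ∘ h) t ⟩
  sub (var ∘ ρ″) t         ≡⟨ sub-var (λ _ → refl) t ⟩
  ren ρ″ t                 ∎

ren-ren-comm : ∀ {ρ₁ ρ₂ ρ₃ ρ₄} → ρ₁ ∘ ρ₂ ≗ ρ₃ ∘ ρ₄ → ren ρ₁ ∘ ren ρ₂ ≗ ren ρ₃ ∘ ren ρ₄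
ren-ren-comm h t = trans (ren-ren h t) (sym (ren-ren (λ _ → refl) t))

ren-lift-suc : ∀ ρ t → ren (lift ρ) (ren suc t) ≡ ren suc (ren ρ t)
ren-lift-suc ρ = ren-ren-comm (λ _ → refl)

ren-exts : ∀ {ρ σ σ′} → ren ρ ∘ σ ≗ σ′ → ren (lift ρ) ∘ exts σ ≗ exts σ′
ren-exts h zero                = refl
ren-exts {ρ} {σ} h (suc i) = trans (ren-lift-suc ρ (σ i)) (cong (ren suc) (h i))

ren-sub : ∀ {ρ σ σ′} → ren ρ ∘ σ ≗ σ′ → ren ρ ∘ sub σ ≗ sub σ′
ren-sub h (var i)      = h i
ren-sub h unit         = refl
ren-sub h (pair t u)   = cong₂ pair (ren-sub h t) (ren-sub h u)
ren-sub h (π₁ t)       = cong π₁ (ren-sub h t)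
ren-sub h (π₂ t)       = cong π₂ (ren-sub h t)
ren-sub h (lam t)      = cong lam (ren-sub (ren-exts h) t)
ren-sub h (app t u)    = cong₂ app (ren-sub h t) (ren-sub h u)
ren-sub h (inl t)      = cong inl (ren-sub h t)
ren-sub h (inr t)      = cong inr (ren-sub h t)
ren-sub h (case s t u) = cong-case (ren-sub h s) (ren-sub (ren-exts h) t) (ren-sub (ren-exts h) u)
ren-sub h (abort t)    = cong abort (ren-sub h t)
ren-sub h (shut t)     = cong shut (ren-sub h t)
ren-sub h (open′ t)    = cong open′ (ren-sub h t)

sub-ren-comm : ∀ {σ ρ ρ′ σ′} → σ ∘ ρ ≗ ren ρ′ ∘ σ′ → sub σ ∘ ren ρ ≗ ren ρ′ ∘ sub σ′
sub-ren-comm h t = trans (sub-ren h t) (sym (ren-sub (λ _ → refl) t))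

ren-σ₀ : ∀ ρ u → ren ρ ∘ σ₀ u ≗ σ₀ (ren ρ u) ∘ lift ρ
ren-σ₀ ρ u zero    = refl
ren-σ₀ ρ u (suc i) = refl

ren-[] : ∀ ρ t u → ren (lift ρ) t [ ren ρ u ] ≡ ren ρ (t [ u ])
ren-[] ρ t u = sub-ren-comm (sym ∘ ren-σ₀ ρ u) t

wk-wk : ∀ m n → wk n ∘ wk m ≗ wk (m + n)
wk-wk m n = ren-ren (λ k → trans (sym (+-assoc n m k)) (cong (_+ k) (+-comm n m)))

-- thin c skips index c: the renaming for a variable inserted at position c.
thin : ℕ → ℕ → ℕ
thin zero    k       = suc k
thin (suc c) zero    = zero
thin (suc c) (suc k) = suc (thin c k)

thin-< : ∀ {c k} → k < c → thin c k ≡ k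
thin-< {suc c} {zero}  _         = refl
thin-< {suc c} {suc k} (s≤s k<c) = cong suc (thin-< k<c)

thin-≥ : ∀ {c k} → c ≤ k → thin c k ≡ suc k
thin-≥ {zero}              _         = refl
thin-≥ {suc c} {suc k} (s≤s c≤k) = cong suc (thin-≥ c≤k)

mv-zero : mv 0 ≗ id
mv-zero zero    = refl
mv-zero (suc k) = refl

mv-suc : ∀ n k → mv (suc n) (suc k) ≡ lift suc (mv n k)
mv-suc zero    zero    = refl
mv-suc zero    (suc k) = refl
mv-suc (suc n) zero    = refl
mv-suc (suc n) (suc k) with k <ᵇ n | k ≡ᵇ n
... | true  | _     = refl
... | false | true  = refl
... | false | false = refl

mv-< : ∀ {n k} → k < n → mv n k ≡ suc k
mv-< {suc n} {zero}  _         = refl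
mv-< {suc n} {suc k} (s≤s k<n) = trans (mv-suc n k) (cong (lift suc) (mv-< k<n))

mv-self : ∀ n → mv n n ≡ 0
mv-self zero    = refl
mv-self (suc n) = trans (mv-suc n n) (cong (lift suc) (mv-self n))

mv-> : ∀ {n k} → n < k → mv n k ≡ k
mv-> {zero}  {suc k}       _         = refl
mv-> {suc n} {suc (suc k)} (s≤s n<k) = trans (mv-suc n (suc k)) (cong (lift suc) (mv-> n<k))

mv-thin : ∀ n k → mv n (thin n k) ≡ suc k
mv-thin zero    k       = refl
mv-thin (suc n) zero    = refl
mv-thin (suc n) (suc k) = trans (mv-suc n (thin n k)) (cong (lift suc) (mv-thin n k))

mv-wk : ∀ m n k → mv (m + n) (n + k) ≡ lift (n +_) (mv m k)
mv-wk m zero    k rewrite +-identityʳ m = sym (lift-id (λ _ → refl) (mv m k))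
mv-wk m (suc n) k rewrite +-suc m n = begin
  mv (suc (m + n)) (suc (n + k))   ≡⟨ mv-suc (m + n) (n + k) ⟩
  lift suc (mv (m + n) (n + k))    ≡⟨ cong (lift suc) (mv-wk m n k) ⟩
  lift suc (lift (n +_) (mv m k))  ≡⟨ lift-∘ suc (n +_) (mv m k) ⟩
  lift (suc n +_) (mv m k)         ∎

mv-mv-thin : ∀ m n k → lift (mv (m + n)) (mv n (thin (suc (m + n)) k)) ≡ lift suc (mv n k)
mv-mv-thin m n k with <-cmp k n
... | tri< k<n _ _
  rewrite thin-< {suc (m + n)} {k} (≤-trans k<n (≤-trans (m≤n+m n m) (n≤1+n _)))
        | mv-< k<n
        | mv-< {m + n} {k} (<-≤-trans k<n (m≤n+m n m)) = refl
... | tri≈ _ refl _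
  rewrite thin-< {suc (m + n)} {n} (s≤s (m≤n+m n m)) | mv-self n = refl
mv-mv-thin m n (suc k) | tri> _ _ n<k with <-cmp (suc k) (suc (m + n))
... | tri< (s≤s k<N) _ _
  rewrite thin-< {suc (m + n)} {suc k} (s≤s k<N) | mv-> n<k | mv-< {m + n} {k} k<N = refl
... | tri≈ _ k≡N _
  rewrite thin-≥ {suc (m + n)} {suc k} (≤-reflexive (sym k≡N))
        | mv-> {n} {suc (suc k)} (≤-trans n<k (n≤1+n _))
        | mv-> {m + n} {suc k} (≤-reflexive (cong suc (sym (suc-injective k≡N)))) | mv-> n<k = refl
... | tri> _ _ N<k
  rewrite thin-≥ {suc (m + n)} {suc k} (<⇒≤ N<k) | mv-> {n} {suc (suc k)} (≤-trans n<k (n≤1+n _))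
        | mv-> {m + n} {suc k} (≤-trans (n≤1+n _) N<k) | mv-> n<k = refl

⧺-assoc : ∀ Γ Δ Θ → ((Γ ⧺ Δ) ⧺ Θ) ≡ (Γ ⧺ (Δ ⧺ Θ))
⧺-assoc Γ Δ ·       = refl
⧺-assoc Γ Δ (Θ , A) = cong (_, A) (⧺-assoc Γ Δ Θ)
⧺-assoc Γ Δ (Θ ,•)  = cong _,• (⧺-assoc Γ Δ Θ)

nvars-⧺ : ∀ Γ Δ → nvars (Γ ⧺ Δ) ≡ nvars Γ + nvars Δ
nvars-⧺ Γ ·       = sym (+-identityʳ _)
nvars-⧺ Γ (Δ , A) = trans (cong suc (nvars-⧺ Γ Δ)) (sym (+-suc _ _))
nvars-⧺ Γ (Δ ,•)  = nvars-⧺ Γ Δ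

LockFree-⧺ : ∀ Γ Δ → LockFree Γ → LockFree Δ → LockFree (Γ ⧺ Δ)
LockFree-⧺ Γ ·       lfΓ _   = lfΓ
LockFree-⧺ Γ (Δ , _) lfΓ lfΔ = LockFree-⧺ Γ Δ lfΓ lfΔ

wk-⧺ : ∀ Δ Θ t → wk (nvars (Δ ⧺ Θ)) t ≡ wk (nvars Θ) (wk (nvars Δ) t)
wk-⧺ Δ Θ t = trans (cong (λ n → wk n t) (nvars-⧺ Δ Θ)) (sym (wk-wk (nvars Δ) (nvars Θ) t))

ren-mv-wk : ∀ Δ Θ t → ren (mv (nvars (Δ ⧺ Θ))) (wk (nvars Θ) t) ≡ ren (lift (nvars Θ +_)) (ren (mv (nvars Δ)) t)
ren-mv-wk Δ Θ t rewrite nvars-⧺ Δ Θ = ren-ren-comm (mv-wk (nvars Δ) (nvars Θ)) t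

ren-mv-thin : ∀ Δ A Θ t →
  ren (lift (mv (nvars (Δ ⧺ Θ)))) (ren (mv (nvars Θ)) (ren (thin (nvars ((Δ , A) ⧺ Θ))) t))
  ≡ ren (lift suc) (ren (mv (nvars Θ)) t)
ren-mv-thin Δ A Θ t rewrite nvars-⧺ Δ Θ | nvars-⧺ (Δ , A) Θ = begin
  ren (lift (mv (m + n))) (ren (mv n) (ren (thin (suc (m + n))) t))
    ≡⟨ cong (ren (lift (mv (m + n)))) (ren-ren (λ _ → refl) t) ⟩
  ren (lift (mv (m + n))) (ren (mv n ∘ thin (suc (m + n))) t)
    ≡⟨ ren-ren-comm (mv-mv-thin m n) t ⟩
  ren (lift suc) (ren (mv n) t) ∎
  where m n : ℕ
        m = nvars Δ
        n = nvars Θ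

cons : Tm → (ℕ → Tm) → ℕ → Tm
cons t σ zero    = t
cons t σ (suc i) = σ i

module Substitution
  (_⊩_∶_ : Ctx → Tm → Ty → Set)
  (⊩⇒⊢    : ∀ {Δ t A} → Δ ⊩ t ∶ A → Δ ⊢ t ∶ A)
  (⊩-zero : ∀ {Δ A} → (Δ , A) ⊩ var 0 ∶ A)
  (⊩-thin : ∀ {Δ} Θ {A t B} → (Δ ⧺ Θ) ⊩ t ∶ B → ((Δ , A) ⧺ Θ) ⊩ ren (thin (nvars Θ)) t ∶ B)
  where

  infix 2 _⊩ˢ_∶_

  data _⊩ˢ_∶_ : Ctx → (ℕ → Tm) → Ctx → Set where
    empty  : ∀ {Δ σ} → Δ ⊩ˢ σ ∶ ·
    extend : ∀ {Δ σ Γ A} → Δ ⊩ˢ σ ∘ suc ∶ Γ → Δ ⊩ σ 0 ∶ A → Δ ⊩ˢ σ ∶ Γ , A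
    lock   : ∀ {Δ Θ σ σ′ Γ} → Δ ⊩ˢ σ ∶ Γ → LockFree Θ → σ′ ≗ wk (nvars Θ) ∘ σ →
             (Δ ,•) ⧺ Θ ⊩ˢ σ′ ∶ Γ ,•

  ⊩ˢ-resp-≗ : ∀ {Δ σ σ′ Γ} → σ ≗ σ′ → Δ ⊩ˢ σ ∶ Γ → Δ ⊩ˢ σ′ ∶ Γ
  ⊩ˢ-resp-≗ h empty = empty
  ⊩ˢ-resp-≗ {Δ} h (extend {A = A} ⊩σ ⊩t) =
    extend (⊩ˢ-resp-≗ (h ∘ suc) ⊩σ) (subst (λ t → Δ ⊩ t ∶ A) (h 0) ⊩t)
  ⊩ˢ-resp-≗ h (lock ⊩σ lf e) = lock ⊩σ lf (λ i → trans (sym (h i)) (e i))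

  weakenˢ : ∀ {Δ σ Γ A} → Δ ⊩ˢ σ ∶ Γ → Δ , A ⊩ˢ ren suc ∘ σ ∶ Γ
  weakenˢ empty          = empty
  weakenˢ (extend ⊩σ ⊩t) = extend (weakenˢ ⊩σ) (⊩-thin · ⊩t)
  weakenˢ (lock {σ = σ} ⊩σ lf e) =
    lock ⊩σ lf (λ i → trans (cong (ren suc) (e i)) (ren-ren (λ _ → refl) (σ i)))

  liftˢ : ∀ {Δ σ Γ A} → Δ ⊩ˢ σ ∶ Γ → Δ , A ⊩ˢ exts σ ∶ Γ , A
  liftˢ ⊩σ = extend (weakenˢ ⊩σ) ⊩-zero

  dropˢ : ∀ {Δ σ Γ} Θ → LockFree Θ → Δ ⊩ˢ σ ∶ Γ ⧺ Θ → Δ ⊩ˢ σ ∘ (nvars Θ +_) ∶ Γ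
  dropˢ ·       _  ⊩σ            = ⊩σ
  dropˢ (Θ , _) lf (extend ⊩σ _) = dropˢ Θ lf ⊩σ

  lookupˢ : ∀ {Δ σ Γ A} Θ → LockFree Θ → Δ ⊩ˢ σ ∶ (Γ , A) ⧺ Θ → Δ ⊩ σ (nvars Θ) ∶ A
  lookupˢ ·       _  (extend _ ⊩t)  = ⊩t
  lookupˢ (Θ , _) lf (extend ⊩σ _) = lookupˢ Θ lf ⊩σ

  idˢ : ∀ Γ → Γ ⊩ˢ var ∶ Γ
  idˢ ·       = empty
  idˢ (Γ , A) = extend (weakenˢ (idˢ Γ)) ⊩-zero
  idˢ (Γ ,•)  = lock {Θ = ·} (idˢ Γ) tt (λ _ → refl)

  thinˢ : ∀ Γ A Θ → (Γ , A) ⧺ Θ ⊩ˢ var ∘ thin (nvars Θ) ∶ Γ ⧺ Θ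
  thinˢ Γ A ·       = weakenˢ (idˢ Γ)
  thinˢ Γ A (Θ , B) = extend (weakenˢ (thinˢ Γ A Θ)) ⊩-zero
  thinˢ Γ A (Θ ,•)  = lock {Θ = ·} (thinˢ Γ A Θ) tt (λ _ → refl)

  -- What pushing σ through case or abort needs, whose premises live in Γ but whose
  -- conclusion lives in Γ ⧺ Θ: the target splits as Δ₁ ⧺ Δ′, σ restricted to Γ
  -- lives over Δ₁, and σ extended to the case-bound variable is, up to the
  -- permutations mv on both sides, a substitution τ A for (Γ , A) ⧺ Θ.
  record Split (Δ : Ctx) (σ : ℕ → Tm) (Γ Θ : Ctx) : Set where
    field
      Δ₁ Δ′ : Ctx
      Δ≡    : Δ ≡ (Δ₁ ⧺ Δ′)
      σ₁    : ℕ → Tm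
      ⊩σ₁   : Δ₁ ⊩ˢ σ₁ ∶ Γ
      σ≗    : σ ∘ (nvars Θ +_) ≗ wk (nvars Δ′) ∘ σ₁
      τ     : Ty → ℕ → Tm
      ⊩τ    : ∀ A → (Δ₁ , A) ⧺ Δ′ ⊩ˢ τ A ∶ (Γ , A) ⧺ Θ
      τ≗    : ∀ A → exts σ ∘ mv (nvars Θ) ≗ ren (mv (nvars Δ′)) ∘ τ A

  split-· : ∀ {Δ σ Γ} → Δ ⊩ˢ σ ∶ Γ → Split Δ σ Γ ·
  split-· {Δ} {σ} ⊩σ = record
    { Δ₁ = Δ ; Δ′ = · ; Δ≡ = refl ; σ₁ = σ ; ⊩σ₁ = ⊩σ ; σ≗ = λ i → sym (wk-zero (σ i))
    ; τ = λ _ → exts σ ; ⊩τ = λ _ → liftˢ ⊩σ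
    ; τ≗ = λ _ i → trans (cong (exts σ) (mv-zero i)) (sym (ren-id mv-zero (exts σ i))) }

  split-, : ∀ {Δ σ Γ Θ B} → Split Δ (σ ∘ suc) Γ Θ → Δ ⊩ σ 0 ∶ B → Split Δ σ Γ (Θ , B)
  split-, {Δ} {σ} {Θ = Θ} {B} sp ⊩t = record
    { Δ₁ = Δ₁ ; Δ′ = Δ′ ; Δ≡ = Δ≡ ; σ₁ = σ₁ ; ⊩σ₁ = ⊩σ₁ ; σ≗ = σ≗
    ; τ = λ A → cons (ren (thin (nvars Δ′)) (σ 0)) (τ A)
    ; ⊩τ = λ A → extend (⊩τ A) (⊩-thin Δ′ (subst (λ Δ → Δ ⊩ σ 0 ∶ B) Δ≡ ⊩t))
    ; τ≗ = τ≗′ }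
    where
      open Split sp
      τ≗′ : ∀ A → exts σ ∘ mv (suc (nvars Θ)) ≗ ren (mv (nvars Δ′)) ∘ cons (ren (thin (nvars Δ′)) (σ 0)) (τ A)
      τ≗′ A zero    = sym (ren-ren (mv-thin (nvars Δ′)) (σ 0))
      τ≗′ A (suc i) = begin
        exts σ (mv (suc (nvars Θ)) (suc i))    ≡⟨ cong (exts σ) (mv-suc (nvars Θ) i) ⟩
        exts σ (lift suc (mv (nvars Θ) i))     ≡⟨ exts-lift (λ _ → refl) (mv (nvars Θ) i) ⟩
        exts (σ ∘ suc) (mv (nvars Θ) i)        ≡⟨ τ≗ A i ⟩
        ren (mv (nvars Δ′)) (τ A i)            ∎

  split-• : ∀ {Δ Θ′ σ σ′ Γ Θ} → Split Δ σ Γ Θ → LockFree Θ′ → σ′ ≗ wk (nvars Θ′) ∘ σ →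
            Split ((Δ ,•) ⧺ Θ′) σ′ Γ (Θ ,•)
  split-• {Θ′ = Θ′} {σ} {σ′} {Θ = Θ} sp lf e = record
    { Δ₁ = Δ₁ ; Δ′ = (Δ′ ,•) ⧺ Θ′
    ; Δ≡ = trans (cong (λ D → (D ,•) ⧺ Θ′) Δ≡) (⧺-assoc Δ₁ (Δ′ ,•) Θ′)
    ; σ₁ = σ₁ ; ⊩σ₁ = ⊩σ₁
    ; σ≗ = λ i → begin
        σ′ (nvars Θ + i)                     ≡⟨ e (nvars Θ + i) ⟩
        wk (nvars Θ′) (σ (nvars Θ + i))      ≡⟨ cong (wk (nvars Θ′)) (σ≗ i) ⟩
        wk (nvars Θ′) (wk (nvars Δ′) (σ₁ i)) ≡⟨ wk-⧺ (Δ′ ,•) Θ′ (σ₁ i) ⟨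
        wk (nvars ((Δ′ ,•) ⧺ Θ′)) (σ₁ i)     ∎
    ; τ = λ A → wk (nvars Θ′) ∘ τ A
    ; ⊩τ = λ A → subst (λ D → D ⊩ˢ wk (nvars Θ′) ∘ τ A ∶ (_ , A) ⧺ (Θ ,•)) (⧺-assoc (Δ₁ , A) (Δ′ ,•) Θ′)
                       (lock (⊩τ A) lf (λ _ → refl))
    ; τ≗ = λ A i → begin
        exts σ′ (mv (nvars Θ) i)                               ≡⟨ ren-exts (sym ∘ e) (mv (nvars Θ) i) ⟨
        ren (lift (nvars Θ′ +_)) (exts σ (mv (nvars Θ) i))     ≡⟨ cong (ren (lift (nvars Θ′ +_))) (τ≗ A i) ⟩
        ren (lift (nvars Θ′ +_)) (ren (mv (nvars Δ′)) (τ A i)) ≡⟨ ren-mv-wk (Δ′ ,•) Θ′ (τ A i) ⟨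
        ren (mv (nvars ((Δ′ ,•) ⧺ Θ′))) (wk (nvars Θ′) (τ A i)) ∎ }
    where open Split sp

  split : ∀ {Δ σ Γ} Θ → Δ ⊩ˢ σ ∶ Γ ⧺ Θ → Split Δ σ Γ Θ
  split ·       ⊩σ              = split-· ⊩σ
  split (Θ , B) (extend ⊩σ ⊩t)  = split-, (split Θ ⊩σ) ⊩t
  split (Θ ,•)  (lock ⊩σ lf e)  = split-• (split Θ ⊩σ) lf e

  ⊢sub : ∀ {Δ σ Γ t A} → Δ ⊩ˢ σ ∶ Γ → Γ ⊢ t ∶ A → Δ ⊢ sub σ t ∶ A
  ⊢sub ⊩σ (⊢var {Γ′ = Θ} lf) = ⊩⇒⊢ (lookupˢ Θ lf ⊩σ)
  ⊢sub ⊩σ ⊢unit            = ⊢unit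
  ⊢sub ⊩σ (⊢pair ⊢t ⊢u)    = ⊢pair (⊢sub ⊩σ ⊢t) (⊢sub ⊩σ ⊢u)
  ⊢sub ⊩σ (⊢π₁ ⊢t)         = ⊢π₁ (⊢sub ⊩σ ⊢t)
  ⊢sub ⊩σ (⊢π₂ ⊢t)         = ⊢π₂ (⊢sub ⊩σ ⊢t)
  ⊢sub ⊩σ (⊢lam ⊢t)        = ⊢lam (⊢sub (liftˢ ⊩σ) ⊢t)
  ⊢sub ⊩σ (⊢app ⊢t ⊢u)     = ⊢app (⊢sub ⊩σ ⊢t) (⊢sub ⊩σ ⊢u)
  ⊢sub ⊩σ (⊢inl ⊢t)        = ⊢inl (⊢sub ⊩σ ⊢t)
  ⊢sub ⊩σ (⊢inr ⊢t)        = ⊢inr (⊢sub ⊩σ ⊢t)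
  ⊢sub ⊩σ (⊢case {Γ′ = Θ} {s} {t} {u} {A} {B} {C} ⊢s ⊢t ⊢u) =
    subst₂ (λ Δ r → Δ ⊢ r ∶ C) (sym Δ≡)
      (sym (cong-case (sub-ren-comm σ≗ s) (sub-ren-comm (τ≗ A) t) (sub-ren-comm (τ≗ B) u)))
      (⊢case (⊢sub ⊩σ₁ ⊢s) (⊢sub (⊩τ A) ⊢t) (⊢sub (⊩τ B) ⊢u))
    where open Split (split Θ ⊩σ)
  ⊢sub ⊩σ (⊢abort {Γ′ = Θ} {t} {A} ⊢t) =
    subst₂ (λ Δ r → Δ ⊢ r ∶ A) (sym Δ≡) (sym (cong abort (sub-ren-comm σ≗ t))) (⊢abort (⊢sub ⊩σ₁ ⊢t))
    where open Split (split Θ ⊩σ)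
  ⊢sub {σ = σ} ⊩σ (⊢shut ⊢t) = ⊢shut (⊢sub (lock {Θ = ·} ⊩σ tt (λ i → sym (wk-zero (σ i)))) ⊢t)
  ⊢sub ⊩σ (⊢open {Γ′ = Θ} {t} {A} lf ⊢t) with dropˢ Θ lf ⊩σ
  ... | lock {Δ = Δ} {Θ = Θ′} ⊩σ′ lf′ e =
    subst (λ r → (Δ ,•) ⧺ Θ′ ⊢ r ∶ A) (sym (cong open′ (sub-ren-comm e t))) (⊢open {Γ′ = Θ′} lf′ (⊢sub ⊩σ′ ⊢t))

infix 2 _∋_∶_
data _∋_∶_ : Ctx → ℕ → Ty → Set where
  here  : ∀ {Γ A} → Γ , A ∋ 0 ∶ A
  there : ∀ {Γ A B i} → Γ ∋ i ∶ A → Γ , B ∋ suc i ∶ A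

∋⇒⊢-⧺ : ∀ {Γ i A} → Γ ∋ i ∶ A → ∀ Θ → LockFree Θ → Γ ⧺ Θ ⊢ var (i + nvars Θ) ∶ A
∋⇒⊢-⧺ here Θ lf = ⊢var lf
∋⇒⊢-⧺ {i = suc i} {A} (there {Γ} {B = B} x) Θ lf =
  subst₂ (λ Δ k → Δ ⊢ var k ∶ A) (sym (⧺-assoc Γ (· , B) Θ))
    (trans (cong (i +_) (nvars-⧺ (· , B) Θ)) (+-suc i (nvars Θ)))
    (∋⇒⊢-⧺ x ((· , B) ⧺ Θ) (LockFree-⧺ (· , B) Θ tt lf))

∋⇒⊢ : ∀ {Γ i A} → Γ ∋ i ∶ A → Γ ⊢ var i ∶ A
∋⇒⊢ {i = i} {A} x = subst (λ k → _ ⊢ var k ∶ A) (+-identityʳ i) (∋⇒⊢-⧺ x · tt)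

∋-thin : ∀ {Γ A i B} Θ → Γ ⧺ Θ ∋ i ∶ B → (Γ , A) ⧺ Θ ∋ thin (nvars Θ) i ∶ B
∋-thin ·       x         = there x
∋-thin (Θ , C) here      = here
∋-thin (Θ , C) (there x) = there (∋-thin Θ x)

infix 2 _⊢ᵛ_∶_
data _⊢ᵛ_∶_ : Ctx → Tm → Ty → Set where
  ⊢ᵛvar : ∀ {Γ i A} → Γ ∋ i ∶ A → Γ ⊢ᵛ var i ∶ A

⊢ᵛ⇒⊢ : ∀ {Γ t A} → Γ ⊢ᵛ t ∶ A → Γ ⊢ t ∶ A
⊢ᵛ⇒⊢ (⊢ᵛvar x) = ∋⇒⊢ x

⊢ᵛ-thin : ∀ {Γ} Θ {A t B} → Γ ⧺ Θ ⊢ᵛ t ∶ B → (Γ , A) ⧺ Θ ⊢ᵛ ren (thin (nvars Θ)) t ∶ B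
⊢ᵛ-thin Θ (⊢ᵛvar x) = ⊢ᵛvar (∋-thin Θ x)

module Ren = Substitution _⊢ᵛ_∶_ ⊢ᵛ⇒⊢ (⊢ᵛvar here) ⊢ᵛ-thin

weaken : ∀ {Γ} Θ {A t B} → Γ ⧺ Θ ⊢ t ∶ B → (Γ , A) ⧺ Θ ⊢ ren (thin (nvars Θ)) t ∶ B
weaken {Γ} Θ {A} {t} {B} ⊢t =
  subst (λ r → (Γ , A) ⧺ Θ ⊢ r ∶ B) (sub-var (λ _ → refl) t) (Ren.⊢sub (Ren.thinˢ Γ A Θ) ⊢t)

module Sub = Substitution _⊢_∶_ id (⊢var {Γ′ = ·} tt) weaken

-- [s/x] for the middle variable x of (Γ , A) ⧺ Θ, in the numbering that the case
-- rule gives to its branches.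
middleˢ : ∀ {Γ s A} Θ → Γ ⊢ s ∶ A → Γ ⧺ Θ Sub.⊩ˢ σ₀ (wk (nvars Θ) s) ∘ mv (nvars Θ) ∶ (Γ , A) ⧺ Θ
middleˢ {Γ} {s} · ⊢s = Sub.⊩ˢ-resp-≗ h (Sub.extend (Sub.idˢ Γ) ⊢s)
  where h : σ₀ s ≗ σ₀ (wk 0 s) ∘ mv 0
        h zero    = sym (wk-zero s)
        h (suc i) = refl
middleˢ {s = s} (Θ , B) ⊢s = Sub.⊩ˢ-resp-≗ h (Sub.liftˢ (middleˢ Θ ⊢s))
  where n : ℕ
        n = nvars Θ
        h : exts (σ₀ (wk n s) ∘ mv n) ≗ σ₀ (wk (suc n) s) ∘ mv (suc n)
        h zero    = refl
        h (suc i) = begin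
          ren suc (σ₀ (wk n s) (mv n i))                  ≡⟨ ren-σ₀ suc (wk n s) (mv n i) ⟩
          σ₀ (ren suc (wk n s)) (lift suc (mv n i))       ≡⟨ cong₂ σ₀ (ren-ren (λ _ → refl) s) (sym (mv-suc n i)) ⟩
          σ₀ (wk (suc n) s) (mv (suc n) (suc i))          ∎
middleˢ (Θ ,•) ⊢s = Sub.lock {Θ = ·} (middleˢ Θ ⊢s) tt (λ _ → sym (wk-zero _))

-- The contractions of ↦, with the frames of the commuting conversions spelled out
-- so that a redex can be matched on.
infix 2 _⇝_
data _⇝_ : Tm → Tm → Set where
  β⇒      : ∀ {t u} → app (lam t) u ⇝ t [ u ]
  β×₁     : ∀ {t u} → π₁ (pair t u) ⇝ t
  β×₂     : ∀ {t u} → π₂ (pair t u) ⇝ u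
  β+₁     : ∀ {s t u} → case (inl s) t u ⇝ t [ s ]
  β+₂     : ∀ {s t u} → case (inr s) t u ⇝ u [ s ]
  β□      : ∀ {t} → open′ (shut t) ⇝ t
  ccApp   : ∀ {s t u v} → app (case s t u) v ⇝ case s (app t (ren suc v)) (app u (ren suc v))
  ccπ₁    : ∀ {s t u} → π₁ (case s t u) ⇝ case s (π₁ t) (π₁ u)
  ccπ₂    : ∀ {s t u} → π₂ (case s t u) ⇝ case s (π₂ t) (π₂ u)
  ccCase  : ∀ {s t u t′ u′} → case (case s t u) t′ u′ ⇝
              case s (case t (ren (lift suc) t′) (ren (lift suc) u′)) (case u (ren (lift suc) t′) (ren (lift suc) u′))
  ccAbort : ∀ {s t u} → abort (case s t u) ⇝ case s (abort t) (abort u)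
  ccOpen  : ∀ {s t u} → open′ (case s t u) ⇝ case s (open′ t) (open′ u)
  caApp   : ∀ {t v} → app (abort t) v ⇝ abort t
  caπ₁    : ∀ {t} → π₁ (abort t) ⇝ abort t
  caπ₂    : ∀ {t} → π₂ (abort t) ⇝ abort t
  caCase  : ∀ {t t′ u′} → case (abort t) t′ u′ ⇝ abort t
  caAbort : ∀ {t} → abort (abort t) ⇝ abort t
  caOpen  : ∀ {t} → open′ (abort t) ⇝ abort t

infix 2 _⟶_
data _⟶_ : Tm → Tm → Set where
  root    : ∀ {t u} → t ⇝ u → t ⟶ u
  ξpair₁  : ∀ {t t′ u} → t ⟶ t′ → pair t u ⟶ pair t′ u
  ξpair₂  : ∀ {t u u′} → u ⟶ u′ → pair t u ⟶ pair t u′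
  ξπ₁     : ∀ {t t′} → t ⟶ t′ → π₁ t ⟶ π₁ t′
  ξπ₂     : ∀ {t t′} → t ⟶ t′ → π₂ t ⟶ π₂ t′
  ξlam    : ∀ {t t′} → t ⟶ t′ → lam t ⟶ lam t′
  ξapp₁   : ∀ {t t′ u} → t ⟶ t′ → app t u ⟶ app t′ u
  ξapp₂   : ∀ {t u u′} → u ⟶ u′ → app t u ⟶ app t u′
  ξinl    : ∀ {t t′} → t ⟶ t′ → inl t ⟶ inl t′
  ξinr    : ∀ {t t′} → t ⟶ t′ → inr t ⟶ inr t′
  ξcase₁  : ∀ {s s′ t u} → s ⟶ s′ → case s t u ⟶ case s′ t u
  ξcase₂  : ∀ {s t t′ u} → t ⟶ t′ → case s t u ⟶ case s t′ u
  ξcase₃  : ∀ {s t u u′} → u ⟶ u′ → case s t u ⟶ case s t u′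
  ξabort  : ∀ {t t′} → t ⟶ t′ → abort t ⟶ abort t′
  ξshut   : ∀ {t t′} → t ⟶ t′ → shut t ⟶ shut t′
  ξopen   : ∀ {t t′} → t ⟶ t′ → open′ t ⟶ open′ t′

↦⇒⟶ : ∀ {t u} → t ↦ u → t ⟶ u
↦⇒⟶ β⇒                     = root β⇒
↦⇒⟶ β×₁                    = root β×₁
↦⇒⟶ β×₂                    = root β×₂
↦⇒⟶ β+₁                    = root β+₁
↦⇒⟶ β+₂                    = root β+₂
↦⇒⟶ β□                     = root β□
↦⇒⟶ (cc-case (appF _))     = root ccApp
↦⇒⟶ (cc-case π₁F)          = root ccπ₁
↦⇒⟶ (cc-case π₂F)          = root ccπ₂
↦⇒⟶ (cc-case (caseF _ _))  = root ccCase
↦⇒⟶ (cc-case abortF)       = root ccAbort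
↦⇒⟶ (cc-case openF)        = root ccOpen
↦⇒⟶ (cc-abort (appF _))    = root caApp
↦⇒⟶ (cc-abort π₁F)         = root caπ₁
↦⇒⟶ (cc-abort π₂F)         = root caπ₂
↦⇒⟶ (cc-abort (caseF _ _)) = root caCase
↦⇒⟶ (cc-abort abortF)      = root caAbort
↦⇒⟶ (cc-abort openF)       = root caOpen
↦⇒⟶ (ξpair₁ r)             = ξpair₁ (↦⇒⟶ r)
↦⇒⟶ (ξpair₂ r)             = ξpair₂ (↦⇒⟶ r)
↦⇒⟶ (ξπ₁ r)                = ξπ₁ (↦⇒⟶ r)
↦⇒⟶ (ξπ₂ r)                = ξπ₂ (↦⇒⟶ r)
↦⇒⟶ (ξlam r)               = ξlam (↦⇒⟶ r)
↦⇒⟶ (ξapp₁ r)              = ξapp₁ (↦⇒⟶ r)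
↦⇒⟶ (ξapp₂ r)              = ξapp₂ (↦⇒⟶ r)
↦⇒⟶ (ξinl r)               = ξinl (↦⇒⟶ r)
↦⇒⟶ (ξinr r)               = ξinr (↦⇒⟶ r)
↦⇒⟶ (ξcase₁ r)             = ξcase₁ (↦⇒⟶ r)
↦⇒⟶ (ξcase₂ r)             = ξcase₂ (↦⇒⟶ r)
↦⇒⟶ (ξcase₃ r)             = ξcase₃ (↦⇒⟶ r)
↦⇒⟶ (ξabort r)             = ξabort (↦⇒⟶ r)
↦⇒⟶ (ξshut r)              = ξshut (↦⇒⟶ r)
↦⇒⟶ (ξopen r)              = ξopen (↦⇒⟶ r)

Unren : (ℕ → ℕ) → (Tm → Tm → Set) → Tm → Tm → Set
Unren ρ R t u = Σ Tm λ t′ → R t t′ × (u ≡ ren ρ t′)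

⇝-unren : ∀ ρ t {u} → ren ρ t ⇝ u → Unren ρ _⇝_ t u
⇝-unren ρ (app (lam t) u)      β⇒      = t [ u ] ,, β⇒ ,, ren-[] ρ t u
⇝-unren ρ (π₁ (pair t u))      β×₁     = t ,, β×₁ ,, refl
⇝-unren ρ (π₂ (pair t u))      β×₂     = u ,, β×₂ ,, refl
⇝-unren ρ (case (inl s) t u)   β+₁     = t [ s ] ,, β+₁ ,, ren-[] ρ t s
⇝-unren ρ (case (inr s) t u)   β+₂     = u [ s ] ,, β+₂ ,, ren-[] ρ u s
⇝-unren ρ (open′ (shut t))     β□      = t ,, β□ ,, refl
⇝-unren ρ (app (case s t u) v) ccApp   =
  _ ,, ccApp ,, cong-case refl (cong (app _) (sym (ren-lift-suc ρ v))) (cong (app _) (sym (ren-lift-suc ρ v)))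
⇝-unren ρ (π₁ (case s t u))    ccπ₁    = _ ,, ccπ₁ ,, refl
⇝-unren ρ (π₂ (case s t u))    ccπ₂    = _ ,, ccπ₂ ,, refl
⇝-unren ρ (case (case s t u) t′ u′) ccCase =
  _ ,, ccCase ,, cong-case refl (cong-case refl (lift-suc-comm t′) (lift-suc-comm u′))
                                (cong-case refl (lift-suc-comm t′) (lift-suc-comm u′))
  where lift-suc-comm : ∀ r → ren (lift suc) (ren (lift ρ) r) ≡ ren (lift (lift ρ)) (ren (lift suc) r)
        lift-suc-comm = ren-ren-comm (λ { zero → refl ; (suc _) → refl })
⇝-unren ρ (abort (case s t u)) ccAbort = _ ,, ccAbort ,, refl
⇝-unren ρ (open′ (case s t u)) ccOpen  = _ ,, ccOpen ,, refl
⇝-unren ρ (app (abort t) v)    caApp   = _ ,, caApp ,, refl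
⇝-unren ρ (π₁ (abort t))       caπ₁    = _ ,, caπ₁ ,, refl
⇝-unren ρ (π₂ (abort t))       caπ₂    = _ ,, caπ₂ ,, refl
⇝-unren ρ (case (abort t) _ _) caCase  = _ ,, caCase ,, refl
⇝-unren ρ (abort (abort t))    caAbort = _ ,, caAbort ,, refl
⇝-unren ρ (open′ (abort t))    caOpen  = _ ,, caOpen ,, refl

⟶-unren : ∀ ρ t {u} → ren ρ t ⟶ u → Unren ρ _⟶_ t u
⟶-unren ρ (pair t u) (ξpair₁ r) with ⟶-unren ρ t r
... | t′ ,, r′ ,, refl = pair t′ u ,, ξpair₁ r′ ,, refl
⟶-unren ρ (pair t u) (ξpair₂ r) with ⟶-unren ρ u r
... | u′ ,, r′ ,, refl = pair t u′ ,, ξpair₂ r′ ,, refl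
⟶-unren ρ (π₁ t) (ξπ₁ r) with ⟶-unren ρ t r
... | t′ ,, r′ ,, refl = π₁ t′ ,, ξπ₁ r′ ,, refl
⟶-unren ρ (π₂ t) (ξπ₂ r) with ⟶-unren ρ t r
... | t′ ,, r′ ,, refl = π₂ t′ ,, ξπ₂ r′ ,, refl
⟶-unren ρ (lam t) (ξlam r) with ⟶-unren (lift ρ) t r
... | t′ ,, r′ ,, refl = lam t′ ,, ξlam r′ ,, refl
⟶-unren ρ (app t u) (ξapp₁ r) with ⟶-unren ρ t r
... | t′ ,, r′ ,, refl = app t′ u ,, ξapp₁ r′ ,, refl
⟶-unren ρ (app t u) (ξapp₂ r) with ⟶-unren ρ u r
... | u′ ,, r′ ,, refl = app t u′ ,, ξapp₂ r′ ,, refl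
⟶-unren ρ (inl t) (ξinl r) with ⟶-unren ρ t r
... | t′ ,, r′ ,, refl = inl t′ ,, ξinl r′ ,, refl
⟶-unren ρ (inr t) (ξinr r) with ⟶-unren ρ t r
... | t′ ,, r′ ,, refl = inr t′ ,, ξinr r′ ,, refl
⟶-unren ρ (case s t u) (ξcase₁ r) with ⟶-unren ρ s r
... | s′ ,, r′ ,, refl = case s′ t u ,, ξcase₁ r′ ,, refl
⟶-unren ρ (case s t u) (ξcase₂ r) with ⟶-unren (lift ρ) t r
... | t′ ,, r′ ,, refl = case s t′ u ,, ξcase₂ r′ ,, refl
⟶-unren ρ (case s t u) (ξcase₃ r) with ⟶-unren (lift ρ) u r
... | u′ ,, r′ ,, refl = case s t u′ ,, ξcase₃ r′ ,, refl
⟶-unren ρ (abort t) (ξabort r) with ⟶-unren ρ t r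
... | t′ ,, r′ ,, refl = abort t′ ,, ξabort r′ ,, refl
⟶-unren ρ (shut t) (ξshut r) with ⟶-unren ρ t r
... | t′ ,, r′ ,, refl = shut t′ ,, ξshut r′ ,, refl
⟶-unren ρ (open′ t) (ξopen r) with ⟶-unren ρ t r
... | t′ ,, r′ ,, refl = open′ t′ ,, ξopen r′ ,, refl
⟶-unren ρ t (root r) with ⇝-unren ρ t r
... | t′ ,, r′ ,, eq = t′ ,, root r′ ,, eq

cast-ctx : ∀ {Γ Γ′ t A} → Γ ≡ Γ′ → Γ ⊢ t ∶ A → Γ′ ⊢ t ∶ A
cast-ctx refl ⊢t = ⊢t

cast-tm : ∀ {Γ t t′ A} → t ≡ t′ → Γ ⊢ t ∶ A → Γ ⊢ t′ ∶ A
cast-tm refl ⊢t = ⊢t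

weaken-⧺ : ∀ {Γ F t B} Δ Θ → Γ ⧺ Δ ⧺ Θ ⊢ t ∶ B → (Γ , F) ⧺ Δ ⧺ Θ ⊢ ren (thin (nvars (Δ ⧺ Θ))) t ∶ B
weaken-⧺ {Γ} {F} Δ Θ ⊢t =
  cast-ctx (sym (⧺-assoc (Γ , F) Δ Θ)) (weaken (Δ ⧺ Θ) (cast-ctx (⧺-assoc Γ Δ Θ) ⊢t))

⊢case-⧺ : ∀ {Γ s t u A B C} Δ Θ → Γ ⊢ s ∶ A ⊕ B → (Γ , A) ⧺ Δ ⧺ Θ ⊢ t ∶ C → (Γ , B) ⧺ Δ ⧺ Θ ⊢ u ∶ C →
  Γ ⧺ Δ ⧺ Θ ⊢ case (wk (nvars Θ) (wk (nvars Δ) s)) (ren (mv (nvars (Δ ⧺ Θ))) t) (ren (mv (nvars (Δ ⧺ Θ))) u) ∶ C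
⊢case-⧺ {Γ} {s} {A = A} {B} Δ Θ ⊢s ⊢t ⊢u =
  cast-ctx (sym (⧺-assoc Γ Δ Θ)) (cast-tm (cong-case (wk-⧺ Δ Θ s) refl refl)
    (⊢case {Γ′ = Δ ⧺ Θ} ⊢s (cast-ctx (⧺-assoc (Γ , A) Δ Θ) ⊢t) (cast-ctx (⧺-assoc (Γ , B) Δ Θ) ⊢u)))

⊢abort-⧺ : ∀ {Γ t A} Δ Θ → Γ ⊢ t ∶ 𝟘 → Γ ⧺ Δ ⧺ Θ ⊢ abort (wk (nvars Θ) (wk (nvars Δ) t)) ∶ A
⊢abort-⧺ {Γ} {t} Δ Θ ⊢t =
  cast-ctx (sym (⧺-assoc Γ Δ Θ)) (cast-tm (cong abort (wk-⧺ Δ Θ t)) (⊢abort {Γ′ = Δ ⧺ Θ} ⊢t))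

⊢-⇝ : ∀ {Γ t u A} → Γ ⊢ t ∶ A → t ⇝ u → Γ ⊢ u ∶ A
⊢-⇝ {Γ} (⊢app (⊢lam ⊢t) ⊢u) β⇒ = Sub.⊢sub (Sub.extend (Sub.idˢ Γ) ⊢u) ⊢t
⊢-⇝ (⊢π₁ (⊢pair ⊢t _)) β×₁ = ⊢t
⊢-⇝ (⊢π₂ (⊢pair _ ⊢u)) β×₂ = ⊢u
⊢-⇝ (⊢case {Γ′ = Θ} {s = inl _} {t = t} (⊢inl ⊢s) ⊢t _) β+₁ =
  cast-tm (sym (sub-ren (λ _ → refl) t)) (Sub.⊢sub (middleˢ Θ ⊢s) ⊢t)
⊢-⇝ (⊢case {Γ′ = Θ} {s = inr _} {u = u} (⊢inr ⊢s) _ ⊢u) β+₂ =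
  cast-tm (sym (sub-ren (λ _ → refl) u)) (Sub.⊢sub (middleˢ Θ ⊢s) ⊢u)
⊢-⇝ (⊢open {Γ} {Θ} {t = shut t} lf (⊢shut ⊢t)) β□ =
  cast-tm (sub-var (λ _ → refl) t) (Sub.⊢sub (Sub.lock {σ′ = var ∘ (nvars Θ +_)} (Sub.idˢ Γ) lf (λ _ → refl)) ⊢t)
⊢-⇝ (⊢app (⊢case {Γ′ = Θ} ⊢s ⊢t ⊢u) ⊢v) ccApp =
  cast-tm (cong-case refl (cong (app _) (ren-ren (mv-thin (nvars Θ)) _)) (cong (app _) (ren-ren (mv-thin (nvars Θ)) _)))
    (⊢case ⊢s (⊢app ⊢t (weaken Θ ⊢v)) (⊢app ⊢u (weaken Θ ⊢v)))
⊢-⇝ (⊢π₁ (⊢case ⊢s ⊢t ⊢u)) ccπ₁ = ⊢case ⊢s (⊢π₁ ⊢t) (⊢π₁ ⊢u)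
⊢-⇝ (⊢π₂ (⊢case ⊢s ⊢t ⊢u)) ccπ₂ = ⊢case ⊢s (⊢π₂ ⊢t) (⊢π₂ ⊢u)
⊢-⇝ (⊢case {Γ′ = Θ} {s = case _ _ _} {t = t′} {u = u′} {A = A} {B = B}
       (⊢case {Γ′ = Δ} {t = t} {u = u} ⊢s ⊢t ⊢u) ⊢t′ ⊢u′) ccCase =
  cast-tm (cong-case refl (cong-case (ren-mv-wk Δ Θ t) (ren-mv-thin Δ A Θ t′) (ren-mv-thin Δ B Θ u′))
                          (cong-case (ren-mv-wk Δ Θ u) (ren-mv-thin Δ A Θ t′) (ren-mv-thin Δ B Θ u′)))
    (⊢case-⧺ Δ Θ ⊢s (⊢case ⊢t (weaken-⧺ (Δ , A) Θ ⊢t′) (weaken-⧺ (Δ , B) Θ ⊢u′))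
                      (⊢case ⊢u (weaken-⧺ (Δ , A) Θ ⊢t′) (weaken-⧺ (Δ , B) Θ ⊢u′)))
⊢-⇝ (⊢abort {Γ′ = Θ} {t = case _ _ _} (⊢case {Γ′ = Δ} {t = t} {u = u} ⊢s ⊢t ⊢u)) ccAbort =
  cast-tm (cong-case refl (cong abort (ren-mv-wk Δ Θ t)) (cong abort (ren-mv-wk Δ Θ u)))
    (⊢case-⧺ Δ Θ ⊢s (⊢abort {Γ′ = Θ} ⊢t) (⊢abort {Γ′ = Θ} ⊢u))
⊢-⇝ (⊢open {Γ′ = Θ} {t = case _ _ _} lf (⊢case {Γ′ = Δ} {t = t} {u = u} ⊢s ⊢t ⊢u)) ccOpen =
  cast-tm (cong-case refl (cong open′ (ren-mv-wk (Δ ,•) Θ t)) (cong open′ (ren-mv-wk (Δ ,•) Θ u)))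
    (⊢case-⧺ (Δ ,•) Θ ⊢s (⊢open lf ⊢t) (⊢open lf ⊢u))
⊢-⇝ (⊢app (⊢abort ⊢t) _) caApp = ⊢abort ⊢t
⊢-⇝ (⊢π₁ (⊢abort ⊢t)) caπ₁ = ⊢abort ⊢t
⊢-⇝ (⊢π₂ (⊢abort ⊢t)) caπ₂ = ⊢abort ⊢t
⊢-⇝ (⊢case {Γ′ = Θ} {s = abort _} (⊢abort {Γ′ = Δ} ⊢t) _ _) caCase = ⊢abort-⧺ Δ Θ ⊢t
⊢-⇝ (⊢abort {Γ′ = Θ} {t = abort _} (⊢abort {Γ′ = Δ} ⊢t)) caAbort = ⊢abort-⧺ Δ Θ ⊢t
⊢-⇝ (⊢open {Γ′ = Θ} {t = abort _} _ (⊢abort {Γ′ = Δ} ⊢t)) caOpen = ⊢abort-⧺ (Δ ,•) Θ ⊢t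

⊢-⟶ : ∀ {Γ t u A} → Γ ⊢ t ∶ A → t ⟶ u → Γ ⊢ u ∶ A
⊢-⟶ ⊢t (root r) = ⊢-⇝ ⊢t r
⊢-⟶ (⊢pair ⊢t ⊢u) (ξpair₁ r) = ⊢pair (⊢-⟶ ⊢t r) ⊢u
⊢-⟶ (⊢pair ⊢t ⊢u) (ξpair₂ r) = ⊢pair ⊢t (⊢-⟶ ⊢u r)
⊢-⟶ (⊢π₁ ⊢t) (ξπ₁ r) = ⊢π₁ (⊢-⟶ ⊢t r)
⊢-⟶ (⊢π₂ ⊢t) (ξπ₂ r) = ⊢π₂ (⊢-⟶ ⊢t r)
⊢-⟶ (⊢lam ⊢t) (ξlam r) = ⊢lam (⊢-⟶ ⊢t r)
⊢-⟶ (⊢app ⊢t ⊢u) (ξapp₁ r) = ⊢app (⊢-⟶ ⊢t r) ⊢u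
⊢-⟶ (⊢app ⊢t ⊢u) (ξapp₂ r) = ⊢app ⊢t (⊢-⟶ ⊢u r)
⊢-⟶ (⊢inl ⊢t) (ξinl r) = ⊢inl (⊢-⟶ ⊢t r)
⊢-⟶ (⊢inr ⊢t) (ξinr r) = ⊢inr (⊢-⟶ ⊢t r)
⊢-⟶ (⊢case {Γ′ = Θ} {s = s} ⊢s ⊢t ⊢u) (ξcase₁ r) with ⟶-unren (nvars Θ +_) s r
... | _ ,, r′ ,, refl = ⊢case (⊢-⟶ ⊢s r′) ⊢t ⊢u
⊢-⟶ (⊢case {Γ′ = Θ} {t = t} ⊢s ⊢t ⊢u) (ξcase₂ r) with ⟶-unren (mv (nvars Θ)) t r
... | _ ,, r′ ,, refl = ⊢case ⊢s (⊢-⟶ ⊢t r′) ⊢u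
⊢-⟶ (⊢case {Γ′ = Θ} {u = u} ⊢s ⊢t ⊢u) (ξcase₃ r) with ⟶-unren (mv (nvars Θ)) u r
... | _ ,, r′ ,, refl = ⊢case ⊢s ⊢t (⊢-⟶ ⊢u r′)
⊢-⟶ (⊢abort {Γ′ = Θ} {t = t} ⊢t) (ξabort r) with ⟶-unren (nvars Θ +_) t r
... | _ ,, r′ ,, refl = ⊢abort (⊢-⟶ ⊢t r′)
⊢-⟶ (⊢shut ⊢t) (ξshut r) = ⊢shut (⊢-⟶ ⊢t r)
⊢-⟶ (⊢open {Γ′ = Θ} {t = t} lf ⊢t) (ξopen r) with ⟶-unren (nvars Θ +_) t r
... | _ ,, r′ ,, refl = ⊢open lf (⊢-⟶ ⊢t r′)

theorem2 : ∀ {Γ t u A} → Γ ⊢ t ∶ A → t ↦ u → Γ ⊢ u ∶ A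
theorem2 ⊢t r = ⊢-⟶ ⊢t (↦⇒⟶ r)
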